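{- Let $(X,p)$ be a context-free grammar in Greibach normal form over a finite alphabet $A$. For all $s\in X^*$ and $w\in A^*$, we have $s\Rightarrow^* w$ if and only if $\hat o(\{s\}_w)=1$ with respect to the grammar automaton generated from $(X,p)$.
   Context: A context-free grammar $(X,p)$ consists of a finite set $X$ of nonterminals (disjoint from $A$) and $p:X\to\mathcal{P}_\omega((A+X)^*)$; write $x\to u$ for $u\in p(x)$. One-step derivation: $v\Rightarrow w$ if $v=v_1xv_2$, $w=v_1uv_2$ with $x\to u$; $\Rightarrow^*$ is its reflexive transitive closure. Greibach normal form: every production is $x\to aw$ with $a\in A$, $w\in X^*$, or $x\to\epsilon$. The grammar coalgebra $(o,\delta):X\to\mathbb{B}\times\mathcal{P}_\omega(X^*)^A$ is $o(x)=1$ iff $x\to\epsilon$, and $x_a:=\delta(x)(a)=\{w\in X^*\mid x\to aw\}$. With $i(1)=\{\epsilon\}$, $i(0)=\emptyset$, the grammar automaton is the $\mathbb{B}\times(-)^A$-coalgebra $(\hat o,\hat\delta)$ on $\mathcal{P}_\omega(X^*)$ (write $S_a:=\hat\delta(S)(a)$) given by: $\hat o(\{\epsilon\})=1$, $\{\epsilon\}_a=\emptyset$; for $x\in X$, $w\in X^*$: $\hat o(\{xw\})=o(x)\wedge\hat o(\{w\})$, $\{xw\}_a=x_a\{w\}\cup i(o(x))\{w\}_a$ (concatenation of languages); for finite $S$: $\hat o(S)=\bigvee_{s\in S}\hat o(\{s\})$, $S_a=\bigcup_{s\in S}\{s\}_a$. Word derivatives: $S_\epsilon=S$, $S_{aw}=(S_a)_w$.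 -}

module Defs where

open import Data.Nat using (ℕ)
open import Data.Fin using (Fin; _≟_)
open import Data.Bool using (Bool; true; false; _∧_; if_then_else_)
open import Data.Sum using (_⊎_; inj₁; inj₂)
open import Data.Product using (Σ; ∃; ∃-syntax; _×_; _,_)
open import Data.Maybe using (Maybe; just; nothing)
open import Data.List using (List; []; _∷_; _++_; map; concatMap; foldl)
open import Data.Bool.ListAction using (any)
open import Data.List.Membership.Propositional using (_∈_)
open import Relation.Binary.PropositionalEquality using (_≡_)
open import Relation.Binary.Construct.Closure.ReflexiveTransitive using (Star)
open import Relation.Nullary using (yes; no)

-- Terminal alphabet A = Fin nA, nonterminals X = Fin nX (finite sets, disjoint via _⊎_).
-- A finite set of right-hand sides is represented by a list.
record Grammar (nA nX : ℕ) : Set where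
  field
    p : Fin nX → List (List (Fin nA ⊎ Fin nX))

module _ {nA nX : ℕ} (G : Grammar nA nX) where
  open Grammar G

  Sym : Set
  Sym = Fin nA ⊎ Fin nX

  _⟶_ : Fin nX → List Sym → Set
  x ⟶ u = u ∈ p x

  data _⇒_ : List Sym → List Sym → Set where
    step : ∀ v₁ x u v₂ → x ⟶ u → (v₁ ++ inj₂ x ∷ v₂) ⇒ (v₁ ++ u ++ v₂)

  _⇒*_ : List Sym → List Sym → Set
  _⇒*_ = Star _⇒_

  GNF : Set
  GNF = ∀ x u → x ⟶ u → (u ≡ []) ⊎ (∃[ a ] ∃[ w ] (u ≡ inj₁ a ∷ map inj₂ w))

  isNil : List Sym → Bool
  isNil [] = true
  isNil (_ ∷ _) = false

  o : Fin nX → Bool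
  o x = any isNil (p x)

  toX : List Sym → Maybe (List (Fin nX))
  toX [] = just []
  toX (inj₁ _ ∷ _) = nothing
  toX (inj₂ y ∷ r) with toX r
  ... | just w = just (y ∷ w)
  ... | nothing = nothing

  extract : Fin nA → List Sym → List (List (Fin nX))
  extract a [] = []
  extract a (inj₂ _ ∷ _) = []
  extract a (inj₁ b ∷ r) with a ≟ b | toX r
  ... | yes _ | just w = w ∷ []
  ... | yes _ | nothing = []
  ... | no _ | _ = []

  δ : Fin nX → Fin nA → List (List (Fin nX))
  δ x a = concatMap (extract a) (p x)

  -- grammar automaton on P_ω(X*) (finite sets as lists)
  ôword : List (Fin nX) → Bool
  ôword [] = true
  ôword (x ∷ w) = o x ∧ ôword w

  derWord : Fin nA → List (Fin nX) → List (List (Fin nX))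
  derWord a [] = []
  derWord a (x ∷ w) =
    map (_++ w) (δ x a) ++ (if o x then derWord a w else [])

  ô : List (List (Fin nX)) → Bool
  ô S = any ôword S

  δ̂ : List (List (Fin nX)) → Fin nA → List (List (Fin nX))
  δ̂ S a = concatMap (derWord a) S

  δ̂* : List (List (Fin nX)) → List (Fin nA) → List (List (Fin nX))
  δ̂* S w = foldl δ̂ S w

-- Both sides reduce to leftmost derivations of a terminal word from a string of
-- nonterminals.  Parse forests are preserved by reversing derivation steps, so a
-- derivation s ⇒* w turns the trivial parse forest of w into one for w from s;
-- in Greibach normal form such a forest reads off as a leftmost derivation.  On
-- the automaton side, the a-derivative of {s} collects exactly the strings
-- reached from s by a leftmost step consuming a (after erasing nullable
-- nonterminals), and ô detects the strings that derive ε.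
module Submission where

open import Defs
open import Data.Nat using (ℕ)
open import Data.Fin using (Fin; _≟_)
open import Data.Bool using (true; T)
open import Data.Bool.Properties using (T-≡; T-∧)
open import Data.Sum using (inj₁; inj₂)
open import Data.Product using (∃-syntax; _×_; _,_)
open import Data.Maybe using (just)
open import Data.List using (List; []; _∷_; [_]; map; _++_)
open import Data.List.Properties using (++-assoc; map-++)
open import Data.List.Membership.Propositional using (_∈_; find; lose)
open import Data.List.Membership.Propositional.Properties using (∈-concatMap⁺; ∈-concatMap⁻)
open import Data.List.Relation.Unary.Any as Any using (Any; here)
open import Data.List.Relation.Unary.Any.Properties
  using (any⁺; any⁻; ++⁺ˡ; ++⁺ʳ; ++⁻; map⁺; map⁻; concatMap⁺; concatMap⁻; singleton⁺; singleton⁻)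
open import Relation.Binary.PropositionalEquality using (_≡_; refl; sym; cong; subst)
open import Relation.Binary.Construct.Closure.ReflexiveTransitive using (ε; _◅_; gmap)
open import Relation.Nullary using (yes; no; contradiction)
open import Function using (_∘_)
open import Function.Bundles using (_⇔_; mk⇔; Equivalence)
open import Function.Related.Propositional using (equivalence; module EquationalReasoning)
open import Function.Construct.Symmetry using (⇔-sym)

module _ {nA nX : ℕ} (G : Grammar nA nX) where
  open Grammar G

  private variable
    a : Fin nA
    x : Fin nX
    c : Sym G
    s t v : List (Fin nX)
    u u′ : List (Sym G)
    w w₁ w₂ : List (Fin nA)

  data Leftmost : List (Fin nX) → List (Fin nA) → Set where
    []     : Leftmost [] []
    ε-step : [] ∈ p x → Leftmost s w → Leftmost (x ∷ s) w
    a-step : (inj₁ a ∷ map inj₂ v) ∈ p x → Leftmost (v ++ s) w → Leftmost (x ∷ s) (a ∷ w)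

  leftmost-++ : Leftmost s w₁ → Leftmost t w₂ → Leftmost (s ++ t) (w₁ ++ w₂)
  leftmost-++ [] l′ = l′
  leftmost-++ (ε-step m l) l′ = ε-step m (leftmost-++ l l′)
  leftmost-++ {t = t} (a-step {v = v} {s = s} m l) l′ =
    a-step m (subst (λ r → Leftmost r _) (++-assoc v s t) (leftmost-++ l l′))

  ∷-⇒* : (c : Sym G) → _⇒*_ G u u′ → _⇒*_ G (c ∷ u) (c ∷ u′)
  ∷-⇒* c = gmap (c ∷_) λ { (step v₁ x u v₂ m) → step (c ∷ v₁) x u v₂ m }

  leftmost⇒⇒* : Leftmost s w → _⇒*_ G (map inj₂ s) (map inj₁ w)
  leftmost⇒⇒* [] = ε
  leftmost⇒⇒* (ε-step {x = x} {s = s} m l) = step [] x [] (map inj₂ s) m ◅ leftmost⇒⇒* l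
  leftmost⇒⇒* (a-step {a = a} {v = v} {x = x} {s = s} m l) =
    step [] x (inj₁ a ∷ map inj₂ v) (map inj₂ s) m ◅
      ∷-⇒* (inj₁ a) (subst (λ r → _⇒*_ G r _) (map-++ inj₂ v s) (leftmost⇒⇒* l))

  data Tree : Sym G → List (Fin nA) → Set
  data Forest : List (Sym G) → List (Fin nA) → Set

  data Tree where
    leaf : Tree (inj₁ a) [ a ]
    node : u ∈ p x → Forest u w → Tree (inj₂ x) w

  data Forest where
    []  : Forest [] []
    _∷_ : Tree c w₁ → Forest u w₂ → Forest (c ∷ u) (w₁ ++ w₂)

  forest-terminals : ∀ w → Forest (map inj₁ w) w
  forest-terminals [] = []
  forest-terminals (a ∷ w) = leaf ∷ forest-terminals w

  forest-++ : Forest u w₁ → Forest u′ w₂ → Forest (u ++ u′) (w₁ ++ w₂)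
  forest-++ [] f′ = f′
  forest-++ {w₂ = w₂} (_∷_ {w₁ = w₁} {w₂ = w₁′} τ f) f′ =
    subst (Forest _) (sym (++-assoc w₁ w₁′ w₂)) (τ ∷ forest-++ f f′)

  forest-split : ∀ u → Forest (u ++ u′) w →
    ∃[ w₁ ] ∃[ w₂ ] (w ≡ w₁ ++ w₂ × Forest u w₁ × Forest u′ w₂)
  forest-split [] f = [] , _ , refl , [] , f
  forest-split (c ∷ u) (_∷_ {w₁ = w₁} τ f) with forest-split u f
  ... | w₂ , w₃ , refl , f₂ , f₃ = w₁ ++ w₂ , w₃ , sym (++-assoc w₁ w₂ w₃) , τ ∷ f₂ , f₃

  forest-⇐ : _⇒_ G u u′ → Forest u′ w → Forest u w
  forest-⇐ (step v₁ x u v₂ m) f with forest-split v₁ f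
  ... | _ , _ , refl , f₁ , f′ with forest-split u f′
  ... | _ , _ , refl , f₂ , f₃ = forest-++ f₁ (node m f₂ ∷ f₃)

  forest-⇐* : _⇒*_ G u u′ → Forest u′ w → Forest u w
  forest-⇐* ε f = f
  forest-⇐* (d ◅ ds) f = forest-⇐ d (forest-⇐* ds f)

  forest⇒leftmost : GNF G → Forest (map inj₂ s) w → Leftmost s w
  forest⇒leftmost {[]} gnf [] = []
  forest⇒leftmost {x ∷ s} gnf (node {u = u} m f ∷ fs) with gnf x u m
  forest⇒leftmost {x ∷ s} gnf (node m [] ∷ fs) | inj₁ refl =
    ε-step m (forest⇒leftmost gnf fs)
  forest⇒leftmost {x ∷ s} gnf (node m (leaf ∷ fv) ∷ fs) | inj₂ (a , v , refl) =
    a-step m (leftmost-++ (forest⇒leftmost gnf fv) (forest⇒leftmost gnf fs))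

  ⇒*⇔leftmost : GNF G → _⇒*_ G (map inj₂ s) (map inj₁ w) ⇔ Leftmost s w
  ⇒*⇔leftmost {w = w} gnf = mk⇔
    (λ d → forest⇒leftmost gnf (forest-⇐* d (forest-terminals w)))
    leftmost⇒⇒*

  T-o⇔ : T (o G x) ⇔ [] ∈ p x
  T-o⇔ {x} = mk⇔
    (λ t → let u , m , nil = find (any⁻ (isNil G) (p x) t) in subst (_∈ p x) (isNil⇒≡[] u nil) m)
    (λ m → any⁺ (isNil G) (lose m _))
    where
    isNil⇒≡[] : ∀ u → T (isNil G u) → u ≡ []
    isNil⇒≡[] [] _ = refl

  T-ôword⇔ : T (ôword G s) ⇔ Leftmost s []
  T-ôword⇔ = mk⇔ to from
    where
    to : T (ôword G s) → Leftmost s []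
    to {[]} _ = []
    to {x ∷ s} t = let tx , ts = Equivalence.to T-∧ t in ε-step (Equivalence.to T-o⇔ tx) (to ts)
    from : Leftmost s [] → T (ôword G s)
    from [] = _
    from (ε-step m l) = Equivalence.from T-∧ (Equivalence.from T-o⇔ m , from l)

  toX-map : ∀ v → toX G (map inj₂ v) ≡ just v
  toX-map [] = refl
  toX-map (y ∷ v) rewrite toX-map v = refl

  toX≡just⇒ : ∀ u → toX G u ≡ just v → u ≡ map inj₂ v
  toX≡just⇒ [] refl = refl
  toX≡just⇒ (inj₂ y ∷ u) e with toX G u in eq
  toX≡just⇒ (inj₂ y ∷ u) refl | just v = cong (inj₂ y ∷_) (toX≡just⇒ u eq)

  ∈-extract⁺ : ∀ a v → v ∈ extract G a (inj₁ a ∷ map inj₂ v)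
  ∈-extract⁺ a v with a ≟ a
  ... | no a≢a = contradiction refl a≢a
  ... | yes _ rewrite toX-map v = here refl

  ∈-extract⁻ : ∀ u → v ∈ extract G a u → u ≡ inj₁ a ∷ map inj₂ v
  ∈-extract⁻ {a = a} (inj₁ b ∷ u) m with a ≟ b | toX G u in eq
  ∈-extract⁻ (inj₁ _ ∷ u) (here refl) | yes refl | just _ = cong (_ ∷_) (toX≡just⇒ u eq)

  ∈-δ⇔ : v ∈ δ G x a ⇔ (inj₁ a ∷ map inj₂ v) ∈ p x
  ∈-δ⇔ {v} {x} {a} = mk⇔
    (λ m → let u , u∈p , v∈ = find (∈-concatMap⁻ (extract G a) m) in
           subst (_∈ p x) (∈-extract⁻ u v∈) u∈p)
    (λ m → ∈-concatMap⁺ (extract G a) (lose m (∈-extract⁺ a v)))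

  derWord-sound : Any (λ s′ → Leftmost s′ w) (derWord G a s) → Leftmost s (a ∷ w)
  derWord-sound {a = a} {s = x ∷ t} l with ++⁻ (map (_++ t) (δ G x a)) l
  ... | inj₁ l₁ = let _ , v∈δ , l′ = find (map⁻ l₁) in a-step (Equivalence.to ∈-δ⇔ v∈δ) l′
  ... | inj₂ l₂ with o G x in ox
  ...   | true = ε-step (Equivalence.to T-o⇔ (Equivalence.from T-≡ ox)) (derWord-sound l₂)

  derWord-complete : Leftmost s (a ∷ w) → Any (λ s′ → Leftmost s′ w) (derWord G a s)
  derWord-complete {a = a} (ε-step {x = x} {s = t} m l)
    rewrite Equivalence.to T-≡ (Equivalence.from T-o⇔ m) =
    ++⁺ʳ (map (_++ t) (δ G x a)) (derWord-complete l)
  derWord-complete (a-step m l) = ++⁺ˡ (map⁺ (lose (Equivalence.from ∈-δ⇔ m) l))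

  T-ô-δ̂*⇔ : ∀ S w → T (ô G (δ̂* G S w)) ⇔ Any (λ s → Leftmost s w) S
  T-ô-δ̂*⇔ S [] = mk⇔
    (Any.map (Equivalence.to T-ôword⇔) ∘ any⁻ (ôword G) S)
    (any⁺ (ôword G) ∘ Any.map (Equivalence.from T-ôword⇔))
  T-ô-δ̂*⇔ S (a ∷ w) = mk⇔
    (Any.map derWord-sound ∘ concatMap⁻ (derWord G a) ∘ Equivalence.to (T-ô-δ̂*⇔ (δ̂ G S a) w))
    (Equivalence.from (T-ô-δ̂*⇔ (δ̂ G S a) w) ∘ concatMap⁺ (derWord G a) ∘ Any.map derWord-complete)

proposition3p6 : ∀ {nA nX : ℕ} (G : Grammar nA nX) → GNF G →
    ∀ (s : List (Fin nX)) (w : List (Fin nA)) →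
    (_⇒*_ G (map inj₂ s) (map inj₁ w)) ⇔ (ô G (δ̂* G (s ∷ []) w) ≡ true)
proposition3p6 G gnf s w = begin
  _⇒*_ G (map inj₂ s) (map inj₁ w)  ∼⟨ ⇒*⇔leftmost G gnf ⟩
  Leftmost G s w                    ∼⟨ mk⇔ singleton⁺ singleton⁻ ⟩
  Any (λ t → Leftmost G t w) [ s ]  ∼⟨ ⇔-sym (T-ô-δ̂*⇔ G [ s ] w) ⟩
  T (ô G (δ̂* G [ s ] w))            ∼⟨ T-≡ ⟩
  ô G (δ̂* G [ s ] w) ≡ true         ∎
  where open EquationalReasoning {k = equivalence}
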